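{- Let $G$ be a finite simple cubic (3-regular) graph that has no subgraph (not necessarily induced) isomorphic to the graph $L$. Then every vertex of $G$ lies on a cycle of length $3$ or on a cycle of length $4$ in $G$.
   Context: The graph $L$ is the tree on $10$ vertices consisting of a root $r$ adjacent to three vertices $x_1,x_2,x_3$, where each $x_i$ is adjacent to two further leaves (the six leaves being distinct), i.e. the tree of depth $2$ in which the root has three children and each child has two children. -}

module Defs where

open import Data.Nat using (ℕ)
open import Data.Fin using (Fin; zero; suc)
open import Data.List using (List; length; filter)
open import Data.Fin.Base using ()
open import Data.List using ()
open import Data.Product using (Σ; _×_; ∃-syntax)
open import Relation.Nullary using (¬_; Dec)
open import Relation.Unary using (Decidable)
open import Relation.Binary.PropositionalEquality using (_≡_; _≢_)
open import Function.Definitions using (Injective)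
import Data.List as L
import Data.Fin as F

record SimpleGraph (n : ℕ) : Set₁ where
  field
    Adj   : Fin n → Fin n → Set
    adj?  : (u v : Fin n) → Dec (Adj u v)
    sym   : ∀ {u v} → Adj u v → Adj v u
    loopless : ∀ v → ¬ Adj v v

open SimpleGraph public

vertices : (n : ℕ) → List (Fin n)
vertices n = L.allFin n

degree : ∀ {n} (G : SimpleGraph n) → Fin n → ℕ
degree {n} G v = length (filter (adj? G v) (vertices n))

Cubic : ∀ {n} → SimpleGraph n → Set
Cubic {n} G = ∀ (v : Fin n) → degree G v ≡ 3

-- The tree L on Fin 10: root 0, children 1,2,3; vertex 1 has leaves 4,5,
-- vertex 2 has leaves 6,7, vertex 3 has leaves 8,9.  Edges listed in one
-- orientation (parent , child).
data LEdge : Fin 10 → Fin 10 → Set where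
  e01 : LEdge (F.# 0) (F.# 1)
  e02 : LEdge (F.# 0) (F.# 2)
  e03 : LEdge (F.# 0) (F.# 3)
  e14 : LEdge (F.# 1) (F.# 4)
  e15 : LEdge (F.# 1) (F.# 5)
  e26 : LEdge (F.# 2) (F.# 6)
  e27 : LEdge (F.# 2) (F.# 7)
  e38 : LEdge (F.# 3) (F.# 8)
  e39 : LEdge (F.# 3) (F.# 9)

ContainsL : ∀ {n} → SimpleGraph n → Set
ContainsL {n} G =
  Σ (Fin 10 → Fin n) λ f →
    Injective _≡_ _≡_ f × (∀ {i j} → LEdge i j → Adj G (f i) (f j))

OnTriangle : ∀ {n} → SimpleGraph n → Fin n → Set
OnTriangle G v = ∃[ b ] ∃[ c ]
  (v ≢ b × v ≢ c × b ≢ c ×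
   Adj G v b × Adj G b c × Adj G c v)

OnSquare : ∀ {n} → SimpleGraph n → Fin n → Set
OnSquare G v = ∃[ b ] ∃[ c ] ∃[ d ]
  (v ≢ b × v ≢ c × v ≢ d × b ≢ c × b ≢ d × c ≢ d ×
   Adj G v b × Adj G b c × Adj G c d × Adj G d v)

-- If v lies on no triangle and no 4-cycle, its three neighbours are pairwise
-- non-adjacent (no triangle), and no two of them have a common neighbour other
-- than v (no 4-cycle).  Hence v, its three neighbours and their six further
-- neighbours are ten distinct vertices spanning a copy of L.  Since lying on a
-- triangle or a 4-cycle is decidable, refuting its negation suffices.
module Submission where

open import Defs
open import Data.Nat using (ℕ)
open import Data.Fin using (Fin; _≟_)
open import Data.Fin.Properties using (any?)
open import Data.Sum using (_⊎_; inj₁; inj₂)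
open import Data.Product using (_×_; _,_; ∃-syntax)
open import Data.List using (List; []; _∷_; filter; length)
open import Data.List.Relation.Unary.All using (All; []; _∷_)
open import Data.List.Relation.Unary.All.Properties using (all-filter)
import Data.List.Relation.Unary.Unique.Propositional as ListUnique
open ListUnique using ([]; _∷_)
open import Data.List.Relation.Unary.Unique.Propositional.Properties using (allFin⁺; filter⁺)
open import Data.Vec using (Vec; []; _∷_; lookup)
open import Data.Vec.Relation.Unary.Unique.Propositional using (Unique; []; _∷_)
open import Data.Vec.Relation.Unary.Unique.Propositional.Properties using (lookup-injective)
open import Data.Vec.Relation.Unary.All using ([]; _∷_)
open import Function using (_∘_)
open import Relation.Nullary using (¬_; yes; no; ¬?; _×-dec_; _⊎-dec_)
open import Relation.Nullary.Decidable using (decidable-stable)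
open import Relation.Unary using (Decidable)
open import Relation.Binary.PropositionalEquality using (_≡_; _≢_; refl) renaming (sym to ≡-sym)

module _ {n : ℕ} (G : SimpleGraph n) where

  private variable
    v x y s t : Fin n

  adj⇒≢ : Adj G x y → x ≢ y
  adj⇒≢ {x} xy refl = loopless G x xy

  ThreeNeighbours : Fin n → Set
  ThreeNeighbours v = ∃[ a ] ∃[ b ] ∃[ c ]
    (a ≢ b × a ≢ c × b ≢ c × Adj G v a × Adj G v b × Adj G v c)

  TwoNeighboursBesides : Fin n → Fin n → Set
  TwoNeighboursBesides v w = ∃[ s ] ∃[ t ]
    (s ≢ t × w ≢ s × w ≢ t × Adj G v s × Adj G v t)

  degree≡3⇒threeNeighbours : degree G v ≡ 3 → ThreeNeighbours v
  degree≡3⇒threeNeighbours {v} deg = extract neighbours deg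
    (filter⁺ (adj? G v) (allFin⁺ n)) (all-filter (adj? G v) (vertices n))
    where
    neighbours : List (Fin n)
    neighbours = filter (adj? G v) (vertices n)

    extract : ∀ xs → length xs ≡ 3 → ListUnique.Unique xs → All (Adj G v) xs →
              ThreeNeighbours v
    extract (a ∷ b ∷ c ∷ []) refl ((a≢b ∷ a≢c ∷ []) ∷ (b≢c ∷ []) ∷ [] ∷ []) (va ∷ vb ∷ vc ∷ []) =
      a , b , c , a≢b , a≢c , b≢c , va , vb , vc

  degree≡3⇒twoNeighboursBesides : degree G v ≡ 3 → ∀ w → TwoNeighboursBesides v w
  degree≡3⇒twoNeighboursBesides deg w with degree≡3⇒threeNeighbours deg
  ... | a , b , c , a≢b , a≢c , b≢c , va , vb , vc with a ≟ w | b ≟ w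
  ... | yes refl | _        = b , c , b≢c , a≢b , a≢c , vb , vc
  ... | no a≢w   | yes refl = a , c , a≢c , a≢b ∘ ≡-sym , b≢c , va , vc
  ... | no a≢w   | no b≢w   = a , b , a≢b , a≢w ∘ ≡-sym , b≢w ∘ ≡-sym , va , vb

  onTriangle? : Decidable (OnTriangle G)
  onTriangle? v = any? λ b → any? λ c →
    ¬? (v ≟ b) ×-dec ¬? (v ≟ c) ×-dec ¬? (b ≟ c) ×-dec
    adj? G v b ×-dec adj? G b c ×-dec adj? G c v

  onSquare? : Decidable (OnSquare G)
  onSquare? v = any? λ b → any? λ c → any? λ d →
    ¬? (v ≟ b) ×-dec ¬? (v ≟ c) ×-dec ¬? (v ≟ d) ×-dec
    ¬? (b ≟ c) ×-dec ¬? (b ≟ d) ×-dec ¬? (c ≟ d) ×-dec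
    adj? G v b ×-dec adj? G b c ×-dec adj? G c d ×-dec adj? G d v

  module _ {v : Fin n} (¬triangle : ¬ OnTriangle G v) (¬square : ¬ OnSquare G v) where

    neighbour≢neighbourOfNeighbour : Adj G v x → Adj G v y → Adj G y t → x ≢ t
    neighbour≢neighbourOfNeighbour vx vy yx refl =
      ¬triangle (_ , _ , adj⇒≢ vy , adj⇒≢ vx , adj⇒≢ yx , vy , yx , SimpleGraph.sym G vx)

    neighboursOfNeighbours-distinct : x ≢ y → Adj G v x → Adj G v y → v ≢ s →
                                      Adj G x s → Adj G y t → s ≢ t
    neighboursOfNeighbours-distinct x≢y vx vy v≢s xs ys refl =
      ¬square (_ , _ , _ , adj⇒≢ vx , v≢s , adj⇒≢ vy , adj⇒≢ xs , x≢y , adj⇒≢ ys ∘ ≡-sym ,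
               vx , xs , SimpleGraph.sym G ys , SimpleGraph.sym G vy)

    noShortCycle⇒containsL : ThreeNeighbours v → (∀ x → TwoNeighboursBesides x v) →
                             ContainsL G
    noShortCycle⇒containsL (a , b , c , a≢b , a≢c , b≢c , va , vb , vc) besides
      with besides a | besides b | besides c
    ... | a₁ , a₂ , a₁≢a₂ , v≢a₁ , v≢a₂ , aa₁ , aa₂
        | b₁ , b₂ , b₁≢b₂ , v≢b₁ , v≢b₂ , bb₁ , bb₂
        | c₁ , c₂ , c₁≢c₂ , v≢c₁ , v≢c₂ , cc₁ , cc₂ =
      lookup ball , (λ {i} {j} → lookup-injective distinct i j) , edge
      where
      ball : Vec (Fin n) 10
      ball = v ∷ a ∷ b ∷ c ∷ a₁ ∷ a₂ ∷ b₁ ∷ b₂ ∷ c₁ ∷ c₂ ∷ []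

      edge : ∀ {i j} → LEdge i j → Adj G (lookup ball i) (lookup ball j)
      edge e01 = va
      edge e02 = vb
      edge e03 = vc
      edge e14 = aa₁
      edge e15 = aa₂
      edge e26 = bb₁
      edge e27 = bb₂
      edge e38 = cc₁
      edge e39 = cc₂

      a≢ : Adj G v y → Adj G y t → a ≢ t
      a≢ = neighbour≢neighbourOfNeighbour va
      b≢ : Adj G v y → Adj G y t → b ≢ t
      b≢ = neighbour≢neighbourOfNeighbour vb
      c≢ : Adj G v y → Adj G y t → c ≢ t
      c≢ = neighbour≢neighbourOfNeighbour vc

      ab : v ≢ s → Adj G a s → Adj G b t → s ≢ t
      ab = neighboursOfNeighbours-distinct a≢b va vb
      ac : v ≢ s → Adj G a s → Adj G c t → s ≢ t
      ac = neighboursOfNeighbours-distinct a≢c va vc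
      bc : v ≢ s → Adj G b s → Adj G c t → s ≢ t
      bc = neighboursOfNeighbours-distinct b≢c vb vc

      distinct : Unique ball
      distinct =
          (adj⇒≢ va ∷ adj⇒≢ vb ∷ adj⇒≢ vc ∷ v≢a₁ ∷ v≢a₂ ∷ v≢b₁ ∷ v≢b₂ ∷ v≢c₁ ∷ v≢c₂ ∷ [])
        ∷ (a≢b ∷ a≢c ∷ adj⇒≢ aa₁ ∷ adj⇒≢ aa₂ ∷ a≢ vb bb₁ ∷ a≢ vb bb₂ ∷ a≢ vc cc₁ ∷ a≢ vc cc₂ ∷ [])
        ∷ (b≢c ∷ b≢ va aa₁ ∷ b≢ va aa₂ ∷ adj⇒≢ bb₁ ∷ adj⇒≢ bb₂ ∷ b≢ vc cc₁ ∷ b≢ vc cc₂ ∷ [])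
        ∷ (c≢ va aa₁ ∷ c≢ va aa₂ ∷ c≢ vb bb₁ ∷ c≢ vb bb₂ ∷ adj⇒≢ cc₁ ∷ adj⇒≢ cc₂ ∷ [])
        ∷ (a₁≢a₂ ∷ ab v≢a₁ aa₁ bb₁ ∷ ab v≢a₁ aa₁ bb₂ ∷ ac v≢a₁ aa₁ cc₁ ∷ ac v≢a₁ aa₁ cc₂ ∷ [])
        ∷ (ab v≢a₂ aa₂ bb₁ ∷ ab v≢a₂ aa₂ bb₂ ∷ ac v≢a₂ aa₂ cc₁ ∷ ac v≢a₂ aa₂ cc₂ ∷ [])
        ∷ (b₁≢b₂ ∷ bc v≢b₁ bb₁ cc₁ ∷ bc v≢b₁ bb₁ cc₂ ∷ [])
        ∷ (bc v≢b₂ bb₂ cc₁ ∷ bc v≢b₂ bb₂ cc₂ ∷ [])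
        ∷ (c₁≢c₂ ∷ [])
        ∷ []
        ∷ []

lemma1 : ∀ {n} (G : SimpleGraph n) → Cubic G → ¬ ContainsL G →
    ∀ (v : Fin n) → OnTriangle G v ⊎ OnSquare G v
lemma1 G cubic ¬L v =
  decidable-stable (onTriangle? G v ⊎-dec onSquare? G v) λ ¬short →
    ¬L (noShortCycle⇒containsL G (¬short ∘ inj₁) (¬short ∘ inj₂)
          (degree≡3⇒threeNeighbours G (cubic v))
          (λ x → degree≡3⇒twoNeighboursBesides G (cubic x) v))
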